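{- Let $A\subseteq[1..m^2]$ be a nonempty set of size $|A|=m$, written $A=\{a_1<\dots<a_m\}$, let $a_0=0$, $a_{m+1}=m^2$, and $B=A\cup\{a_0\}$. Let $k=1+\lfloor\log_2 m\rfloor$ and $T=\bigodot_{i=0}^{m}\Big(\big(1\cdot\mathrm{ebin}_k(i)\big)^{a_{i+1}-a_i}\cdot\big(\mathrm{ebin}_k(i)\big)^{m^2-(a_{i+1}-a_i)}\Big)\in\{0,1\}^*$. Let $\alpha=|\{j: T[j..|T|]\prec 1^{k+2}0\}|$ and $\beta=|\{j: T[j..|T|]\prec 1^{k+1}0\}|$. Then for every $x\in[1..m^2]$, $\mathrm{Pred}(B,x)=a_i$, where $i=\Big\lceil\frac{\mathrm{LF}^{ -1}_T[\alpha+x]-\beta}{m^2}\Big\rceil-1$.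
   Context: $\mathrm{bin}_k(x)\in\{0,1\}^k$ is the binary representation of $x\in[0..2^k)$ with leading zeros, and $\mathrm{ebin}_k(x)=1^{k+1}\cdot0\cdot\mathrm{bin}_k(x)\cdot0$. $S^t$ is $t$ copies of $S$; $0\prec1$. Lexicographic order: a proper prefix is smaller, otherwise compare at first difference. $\mathrm{Pred}(B,x)=\max(\{y\in B: y<x\}\cup\{ -\infty\})$. For a string $S$ of length $N$: $\mathrm{SA}_S$ lists its suffix starting positions in increasing lexicographic order, $\mathrm{ISA}_S$ its inverse; $\mathrm{LF}_S[i]=\mathrm{ISA}_S[\mathrm{SA}_S[i]-1]$ if $\mathrm{SA}_S[i]\ne1$ and $\mathrm{ISA}_S[N]$ otherwise; $\mathrm{LF}^{ -1}_S$ is its inverse permutation. -}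

module Defs where

open import Data.Bool using (Bool; true; false; if_then_else_; _∧_; _∨_; not)
open import Data.Nat using (ℕ; zero; suc; _+_; _*_; _∸_; _<ᵇ_; _≡ᵇ_; _<?_; _/_; _%_; _⊔_)
open import Data.Nat.Logarithm using (⌊log₂_⌋)
open import Data.Integer as ℤ using (ℤ; +_; -[1+_])
open import Data.Fin using (Fin; fromℕ<)
open import Data.List using (List; []; _∷_; _++_; replicate; concat; concatMap; upTo; map; length; drop; tabulate; filterᵇ)
open import Data.Maybe using (Maybe; just; nothing)
open import Relation.Nullary using (yes; no)

-- Bits: 0 = false, 1 = true.
Str : Set
Str = List Bool

pow : Str → ℕ → Str
pow S t = concat (replicate t S)

bin : ℕ → ℕ → Str
bin zero    x = []
bin (suc k) x = bin k (x / 2) ++ ((x % 2 ≡ᵇ 1) ∷ [])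

ebin : ℕ → ℕ → Str
ebin k x = replicate (suc k) true ++ (false ∷ bin k x ++ (false ∷ []))

_≺ᵇ_ : Str → Str → Bool
[]          ≺ᵇ []      = false
[]          ≺ᵇ (_ ∷ _) = true
(_ ∷ _)     ≺ᵇ []      = false
(false ∷ u) ≺ᵇ (false ∷ v) = u ≺ᵇ v
(true ∷ u)  ≺ᵇ (true ∷ v)  = u ≺ᵇ v
(false ∷ u) ≺ᵇ (true ∷ v)  = true
(true ∷ u)  ≺ᵇ (false ∷ v) = false

-- the suffix S[j..|S|] (1-indexed positions)
suffix : Str → ℕ → Str
suffix S j = drop (j ∸ 1) S

range1 : ℕ → List ℕ
range1 n = map suc (upTo n)

count : {A : Set} → (A → Bool) → List A → ℕ
count p xs = length (filterᵇ p xs)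

module _ (S : Str) where
  insertPos : ℕ → List ℕ → List ℕ
  insertPos j [] = j ∷ []
  insertPos j (j' ∷ js) =
    if suffix S j ≺ᵇ suffix S j' then j ∷ j' ∷ js else j' ∷ insertPos j js

  sortPos : List ℕ → List ℕ
  sortPos [] = []
  sortPos (j ∷ js) = insertPos j (sortPos js)

  SAlist : List ℕ
  SAlist = sortPos (range1 (length S))

-- 1-indexed lookup (default 0 when out of range)
at : List ℕ → ℕ → ℕ
at []       _             = 0
at (y ∷ ys) zero          = 0
at (y ∷ ys) (suc zero)    = y
at (y ∷ ys) (suc (suc i)) = at ys (suc i)

-- 1-indexed position of the first occurrence of v (default 0)
indexOf : List ℕ → ℕ → ℕ
indexOf []       v = 0
indexOf (y ∷ ys) v = if y ≡ᵇ v then 1 else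
  (if indexOf ys v ≡ᵇ 0 then 0 else suc (indexOf ys v))

SA : Str → ℕ → ℕ
SA S i = at (SAlist S) i

ISA : Str → ℕ → ℕ
ISA S j = indexOf (SAlist S) j

LF : Str → ℕ → ℕ
LF S i = if SA S i ≡ᵇ 1 then ISA S (length S) else ISA S (SA S i ∸ 1)

-- inverse permutation of LF on [1..N]: the r-th entry is the i with LF[i] = r
LFinv : Str → ℕ → ℕ
LFinv S r = at (range1 (length S)) (indexOf (map (LF S) (range1 (length S))) r)

Tstr : ℕ → ℕ → (ℕ → ℕ) → Str
Tstr m k a = concatMap block (upTo (suc m))
  where
  block : ℕ → Str
  block i = pow (true ∷ ebin k i) (a (suc i) ∸ a i)
         ++ pow (ebin k i) (m * m ∸ (a (suc i) ∸ a i))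

-- extended sequence: a_0 = 0, a_i (1 ≤ i ≤ m) from a : Fin m → ℕ (a_1 = a zero), a_{m+1} = m²
ext : (m : ℕ) → (Fin m → ℕ) → ℕ → ℕ
ext m a zero = 0
ext m a (suc i) with i <? m
... | yes i<m = a (fromℕ< i<m)
... | no  _   = m * m

-- Pred(B, x) = max {y ∈ B : y < x}, with nothing standing for -∞
Pred : List ℕ → ℕ → Maybe ℕ
Pred []       x = nothing
Pred (y ∷ ys) x with Pred ys x | y <ᵇ x
... | r       | false = r
... | nothing | true  = just y
... | just z  | true  = just (y ⊔ z)

-- ceiling of an integer divided by a positive natural d (d = 0 is never used)
ceilDiv : ℤ → ℕ → ℤ
ceilDiv n        zero    = + 0
ceilDiv (+ p)    (suc d) = + ((p + d) / suc d)
ceilDiv -[1+ p ] (suc d) = ℤ.- (+ (suc p / suc d))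

-- The string T is a concatenation of units: block b consists of a_{b+1} − a_b marked units
-- 1·ebin_k(b) followed by plain units ebin_k(b), m² units per block.  Every unit starts with
-- 1^{k+1}0 and has no other run of k+1 ones, so a suffix of T starting strictly inside a unit
-- has a 0 among its first k+1 symbols and lies below 1^{k+1}0.  Hence the suffixes not below
-- 1^{k+2}0 are exactly the m² suffixes starting at marked units; as bin_k is order preserving
-- they are sorted by block, so the suffix of rank α + x starts with 1·ebin_k(b) for the b with
-- a_b < x ≤ a_{b+1}.  LF⁻¹ moves to the suffix one position later, which starts with ebin_k(b).
-- The suffixes between 1^{k+1}0 and 1^{k+2}0 are those starting with ebin_k(c), m² for every
-- block c and again sorted by block, so this suffix has rank β + D with b·m² ≤ D < (b+1)·m²,
-- and the ceiling in the statement recovers b.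

{-# OPTIONS --safe #-}
module Submission where

open import Defs
open import Data.Bool using (Bool; true; false; not; _∧_; if_then_else_)
import Data.Bool as Bool
open import Data.Bool.Properties using (if-float; ∧-zeroʳ)
open import Data.Empty using (⊥-elim)
open import Data.Fin as F using (Fin; fromℕ<; toℕ)
open import Data.Fin.Properties using (fromℕ<-toℕ; toℕ-fromℕ<; toℕ<n)
open import Data.Integer as ℤ using (ℤ; +_)
open import Data.Integer.Properties using ([+m]-[+n]≡m⊖n; ⊖-≥)
open import Data.List using (List; []; _∷_; _++_; [_]; replicate; concat; map; length; drop; upTo; applyUpTo; tabulate; filterᵇ)
open import Data.List.Properties
  using (++-assoc; ++-identityʳ; length-++; length-drop; length-map; length-replicate; length-upTo; map-upTo; map-applyUpTo; filter-++)
open import Data.List.Membership.Propositional using (_∈_)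
open import Data.List.Membership.Propositional.Properties using (∈-map⁺; ∈-map⁻; ∈-upTo⁺; ∈-upTo⁻; ∈-tabulate⁺; ∈-tabulate⁻)
open import Data.List.Relation.Unary.All as All using (All; []; _∷_)
open import Data.List.Relation.Unary.All.Properties using (++⁺; applyUpTo⁺₁)
open import Data.List.Relation.Unary.Any using (here; there)
open import Data.List.Relation.Unary.AllPairs as AllPairs using (AllPairs; []; _∷_)
import Data.List.Relation.Unary.AllPairs.Properties as AllPairsₚ
open import Data.List.Relation.Unary.Unique.Propositional using (Unique)
import Data.List.Relation.Unary.Unique.Propositional.Properties as Unique
open import Data.List.Relation.Binary.Permutation.Propositional using (_↭_; ↭-refl; ↭-prep; ↭-swap; ↭-trans; ↭-sym)
open import Data.List.Relation.Binary.Permutation.Propositional.Properties using (All-resp-↭; ∈-resp-↭; ↭-length; filter-↭)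
open import Data.Maybe using (just; nothing)
open import Data.Nat
open import Data.Nat.DivMod using (m≡m%n+[m/n]*n; m%n<n; m<n*o⇒m/o<n; /-monoˡ-≤; m*n/n≡m)
open import Data.Nat.ListAction using (sum)
open import Data.Nat.Logarithm using (⌊log₂_⌋; ⌊log₂⌋-mono-≤; ⌊log₂[2^n]⌋≡n)
open import Data.Nat.Properties
open import Data.Product using (∃; ∃-syntax; _×_; _,_; proj₂)
open import Data.Sum using (inj₁; inj₂)
open import Function using (_∘_; id)
open import Relation.Binary.Definitions using (tri<; tri≈; tri>)
open import Relation.Binary.PropositionalEquality hiding ([_])
open import Relation.Nullary using (¬_; yes; no; contradiction)
open import Relation.Nullary.Decidable using (T?; dec-true; dec-false)

-- Lexicographic order

≺ᵇ-irrefl : ∀ u → u ≺ᵇ u ≡ false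
≺ᵇ-irrefl []          = refl
≺ᵇ-irrefl (false ∷ u) = ≺ᵇ-irrefl u
≺ᵇ-irrefl (true ∷ u)  = ≺ᵇ-irrefl u

≺ᵇ-trans : ∀ u v w → u ≺ᵇ v ≡ true → v ≺ᵇ w ≡ true → u ≺ᵇ w ≡ true
≺ᵇ-trans []          (_ ∷ _)     (_ ∷ _)     _ _ = refl
≺ᵇ-trans (false ∷ u) (false ∷ v) (false ∷ w) p q = ≺ᵇ-trans u v w p q
≺ᵇ-trans (false ∷ u) (false ∷ v) (true ∷ w)  _ _ = refl
≺ᵇ-trans (false ∷ u) (true ∷ v)  (true ∷ w)  _ _ = refl
≺ᵇ-trans (true ∷ u)  (true ∷ v)  (true ∷ w)  p q = ≺ᵇ-trans u v w p q
≺ᵇ-trans []          []          _           () _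
≺ᵇ-trans (_ ∷ _)     []          _           () _
≺ᵇ-trans (true ∷ _)  (false ∷ _) _           () _
≺ᵇ-trans _           (_ ∷ _)     []          _ ()
≺ᵇ-trans (false ∷ _) (true ∷ _)  (false ∷ _) _ ()
≺ᵇ-trans (true ∷ _)  (true ∷ _)  (false ∷ _) _ ()

≺ᵇ-asym : ∀ u v → u ≺ᵇ v ≡ true → v ≺ᵇ u ≡ false
≺ᵇ-asym []          (_ ∷ _)     _ = refl
≺ᵇ-asym (false ∷ u) (false ∷ v) p = ≺ᵇ-asym u v p
≺ᵇ-asym (false ∷ u) (true ∷ v)  _ = refl
≺ᵇ-asym (true ∷ u)  (true ∷ v)  p = ≺ᵇ-asym u v p
≺ᵇ-asym []          []          ()
≺ᵇ-asym (_ ∷ _)     []          ()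
≺ᵇ-asym (true ∷ _)  (false ∷ _) ()

≺ᵇ-connex : ∀ u v → u ≢ v → u ≺ᵇ v ≡ false → v ≺ᵇ u ≡ true
≺ᵇ-connex []          []          u≢v _ = ⊥-elim (u≢v refl)
≺ᵇ-connex (_ ∷ _)     []          _   _ = refl
≺ᵇ-connex (false ∷ u) (false ∷ v) u≢v p = ≺ᵇ-connex u v (λ u≡v → u≢v (cong (false ∷_) u≡v)) p
≺ᵇ-connex (true ∷ u)  (false ∷ v) _   _ = refl
≺ᵇ-connex (true ∷ u)  (true ∷ v)  u≢v p = ≺ᵇ-connex u v (λ u≡v → u≢v (cong (true ∷_) u≡v)) p
≺ᵇ-connex []          (_ ∷ _)     _   ()
≺ᵇ-connex (false ∷ _) (true ∷ _)  _   ()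

≺ᵇ-++ʳ : ∀ u P Y → u ≺ᵇ P ≡ true → u ≺ᵇ (P ++ Y) ≡ true
≺ᵇ-++ʳ []          (_ ∷ _)     _ _ = refl
≺ᵇ-++ʳ (false ∷ u) (false ∷ P) Y p = ≺ᵇ-++ʳ u P Y p
≺ᵇ-++ʳ (false ∷ u) (true ∷ P)  _ _ = refl
≺ᵇ-++ʳ (true ∷ u)  (true ∷ P)  Y p = ≺ᵇ-++ʳ u P Y p
≺ᵇ-++ʳ []          []          _ ()
≺ᵇ-++ʳ (_ ∷ _)     []          _ ()
≺ᵇ-++ʳ (true ∷ _)  (false ∷ _) _ ()

++-⊀ᵇ : ∀ P Y → (P ++ Y) ≺ᵇ P ≡ false
++-⊀ᵇ []          []      = refl
++-⊀ᵇ []          (_ ∷ _) = refl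
++-⊀ᵇ (false ∷ P) Y       = ++-⊀ᵇ P Y
++-⊀ᵇ (true ∷ P)  Y       = ++-⊀ᵇ P Y

≺ᵇ-cancelˡ : ∀ P u v → (P ++ u) ≺ᵇ (P ++ v) ≡ u ≺ᵇ v
≺ᵇ-cancelˡ []          u v = refl
≺ᵇ-cancelˡ (false ∷ P) u v = ≺ᵇ-cancelˡ P u v
≺ᵇ-cancelˡ (true ∷ P)  u v = ≺ᵇ-cancelˡ P u v

data ZeroWithin : ℕ → Str → Set where
  here  : ∀ {n t} → ZeroWithin (suc n) (false ∷ t)
  there : ∀ {n t} → ZeroWithin n t → ZeroWithin (suc n) (true ∷ t)

zeroWithin-≺ᵇ : ∀ {n t} Y → ZeroWithin n t → t ≺ᵇ (replicate n true ++ Y) ≡ true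
zeroWithin-≺ᵇ Y here      = refl
zeroWithin-≺ᵇ Y (there z) = zeroWithin-≺ᵇ Y z

zeroWithin-mono : ∀ {m n t} → m ≤ n → ZeroWithin m t → ZeroWithin n t
zeroWithin-mono (s≤s _)   here      = here
zeroWithin-mono (s≤s m≤n) (there z) = there (zeroWithin-mono m≤n z)

zeroWithin-++ : ∀ u Y → ZeroWithin (suc (length u)) (u ++ false ∷ Y)
zeroWithin-++ []          Y = here
zeroWithin-++ (false ∷ u) Y = here
zeroWithin-++ (true ∷ u)  Y = there (zeroWithin-++ u Y)

1ⁿ⁺¹-⊀ᵇ-1ⁿ0 : ∀ n Y X → (true ∷ replicate n true ++ Y) ≺ᵇ (replicate n true ++ false ∷ X) ≡ false
1ⁿ⁺¹-⊀ᵇ-1ⁿ0 zero    Y X = refl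
1ⁿ⁺¹-⊀ᵇ-1ⁿ0 (suc n) Y X = 1ⁿ⁺¹-⊀ᵇ-1ⁿ0 n Y X

-- Counting

module _ {A : Set} where

  count-++ : ∀ (p : A → Bool) xs ys → count p (xs ++ ys) ≡ count p xs + count p ys
  count-++ p xs ys = trans (cong length (filter-++ (T? ∘ p) xs ys)) (length-++ (filterᵇ p xs))

  count-↭ : ∀ (p : A → Bool) {xs ys} → xs ↭ ys → count p xs ≡ count p ys
  count-↭ p xs↭ys = ↭-length (filter-↭ (T? ∘ p) xs↭ys)

  count-map : ∀ {B : Set} (p : B → Bool) (f : A → B) xs → count p (map f xs) ≡ count (p ∘ f) xs
  count-map p f []       = refl
  count-map p f (x ∷ xs) with p (f x)
  ... | true  = cong suc (count-map p f xs)
  ... | false = count-map p f xs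

  count-mono : ∀ {p q : A → Bool} → (∀ t → p t ≡ true → q t ≡ true) → ∀ xs → count p xs ≤ count q xs
  count-mono p⇒q []       = z≤n
  count-mono {p} {q} p⇒q (x ∷ xs) with p x in px | q x in qx
  ... | true  | true  = s≤s (count-mono p⇒q xs)
  ... | false | true  = m≤n⇒m≤1+n (count-mono p⇒q xs)
  ... | false | false = count-mono p⇒q xs
  ... | true  | false with () ← trans (sym (p⇒q x px)) qx

  count-mono-< : ∀ {p q : A → Bool} → (∀ t → p t ≡ true → q t ≡ true) →
                 ∀ {y xs} → y ∈ xs → p y ≡ false → q y ≡ true → count p xs < count q xs
  count-mono-< {p} {q} p⇒q {xs = x ∷ xs} (here refl) py qy rewrite py | qy = s≤s (count-mono p⇒q xs)
  count-mono-< {p} {q} p⇒q {xs = x ∷ xs} (there y∈xs) py qy with p x in px | q x in qx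
  ... | true  | true  = s≤s (count-mono-< p⇒q y∈xs py qy)
  ... | false | true  = m≤n⇒m≤1+n (count-mono-< p⇒q y∈xs py qy)
  ... | false | false = count-mono-< p⇒q y∈xs py qy
  ... | true  | false with () ← trans (sym (p⇒q x px)) qx

  count-split : ∀ {p q : A → Bool} → (∀ t → q t ≡ true → p t ≡ true) →
                ∀ xs → count p xs ≡ count q xs + count (λ t → not (q t) ∧ p t) xs
  count-split q⇒p [] = refl
  count-split {p} {q} q⇒p (x ∷ xs) with q x in qx | p x in px
  ... | true  | true  = cong suc (count-split q⇒p xs)
  ... | false | true  = trans (cong suc (count-split q⇒p xs)) (sym (+-suc _ _))
  ... | false | false = count-split q⇒p xs
  ... | true  | false with () ← trans (sym (q⇒p x qx)) px

  count-+-count-not : ∀ (p : A → Bool) xs → count p xs + count (not ∘ p) xs ≡ length xs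
  count-+-count-not p []       = refl
  count-+-count-not p (x ∷ xs) with p x
  ... | true  = cong suc (count-+-count-not p xs)
  ... | false = trans (+-suc _ _) (cong suc (count-+-count-not p xs))

  count-none : ∀ {p : A → Bool} {xs} → All (λ x → p x ≡ false) xs → count p xs ≡ 0
  count-none []                 = refl
  count-none (px≡false ∷ pxs) rewrite px≡false = count-none pxs

  count-[x]-true : ∀ (p : A → Bool) {x} → p x ≡ true → count p [ x ] ≡ 1
  count-[x]-true p px≡true rewrite px≡true = refl

  count-[x]-false : ∀ (p : A → Bool) {x} → p x ≡ false → count p [ x ] ≡ 0
  count-[x]-false p px≡false rewrite px≡false = refl

-- Suffixes

sufs : Str → List Str
sufs []      = []
sufs (c ∷ s) = (c ∷ s) ∷ sufs s

sufs-++ : ∀ u v → sufs (u ++ v) ≡ map (_++ v) (sufs u) ++ sufs v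
sufs-++ []      v = refl
sufs-++ (c ∷ u) v = cong ((c ∷ u ++ v) ∷_) (sufs-++ u v)

length-sufs : ∀ S → length (sufs S) ≡ length S
length-sufs []      = refl
length-sufs (c ∷ S) = cong suc (length-sufs S)

range1-applyUpTo : ∀ n → range1 n ≡ applyUpTo suc n
range1-applyUpTo = map-upTo suc

∈-range1⁺ : ∀ {n i} → i < n → suc i ∈ range1 n
∈-range1⁺ i<n = ∈-map⁺ suc (∈-upTo⁺ i<n)

∈-range1⁻ : ∀ {n j} → j ∈ range1 n → ∃[ i ] (j ≡ suc i × i < n)
∈-range1⁻ j∈ with i , i∈ , refl ← ∈-map⁻ suc j∈ = i , refl , ∈-upTo⁻ i∈

sufs-applyUpTo : ∀ S → applyUpTo (λ i → drop i S) (length S) ≡ sufs S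
sufs-applyUpTo []      = refl
sufs-applyUpTo (c ∷ S) = cong ((c ∷ S) ∷_) (sufs-applyUpTo S)

map-suffix-range1 : ∀ S → map (suffix S) (range1 (length S)) ≡ sufs S
map-suffix-range1 S = begin
  map (suffix S) (range1 (length S))      ≡⟨ cong (map (suffix S)) (range1-applyUpTo (length S)) ⟩
  map (suffix S) (applyUpTo suc (length S)) ≡⟨ map-applyUpTo suc (suffix S) (length S) ⟩
  applyUpTo (λ i → drop i S) (length S)   ≡⟨ sufs-applyUpTo S ⟩
  sufs S                                  ∎
  where open ≡-Reasoning

suffix-∈-sufs : ∀ S {j} → j ∈ range1 (length S) → suffix S j ∈ sufs S
suffix-∈-sufs S {j} j∈ = subst (suffix S j ∈_) (map-suffix-range1 S) (∈-map⁺ (suffix S) j∈)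

suffix-suc : ∀ S q {c t} → suffix S (suc q) ≡ c ∷ t → suffix S (suc (suc q)) ≡ t
suffix-suc S q = drop-tail q S
  where
  drop-tail : ∀ n (xs : Str) {c t} → drop n xs ≡ c ∷ t → drop (suc n) xs ≡ t
  drop-tail zero    (x ∷ xs) refl = refl
  drop-tail (suc n) (x ∷ xs) eq   = drop-tail n xs eq

drop-≡-∷⇒< : ∀ n (xs : Str) {y ys} → drop n xs ≡ y ∷ ys → n < length xs
drop-≡-∷⇒< zero    (x ∷ xs) _  = z<s
drop-≡-∷⇒< (suc n) (x ∷ xs) eq = s<s (drop-≡-∷⇒< n xs eq)

rank : Str → Str → ℕ
rank S X = count (_≺ᵇ X) (sufs S)

rank-≤-++ : ∀ S X Z → rank S X ≤ rank S (X ++ Z)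
rank-≤-++ S X Z = count-mono (λ t t≺X → ≺ᵇ-++ʳ t X Z t≺X) (sufs S)

rank-< : ∀ S {X Y} → X ∈ sufs S → X ≺ᵇ Y ≡ true → rank S X < rank S Y
rank-< S {X} {Y} X∈ X≺Y = count-mono-< (λ t t≺X → ≺ᵇ-trans t X Y t≺X X≺Y) X∈ (≺ᵇ-irrefl X) X≺Y

count-suffixes : ∀ S (p : Str → Bool) → count (λ j → p (suffix S j)) (range1 (length S)) ≡ count p (sufs S)
count-suffixes S p = trans (sym (count-map p (suffix S) (range1 (length S)))) (cong (count p) (map-suffix-range1 S))

zeroWithin-sufs : ∀ {n} v Y W → length v ≤ n → All (ZeroWithin (suc n)) (map (_++ W) (sufs Y)) →
                  All (ZeroWithin (suc n)) (map (_++ W) (sufs (v ++ false ∷ Y)))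
zeroWithin-sufs []      Y W _   zY = here ∷ zY
zeroWithin-sufs (c ∷ v) Y W c∷v≤n zY =
  zeroWithin-mono (s≤s c∷v≤n) (subst (ZeroWithin _) (sym (++-assoc (c ∷ v) (false ∷ Y) W)) (zeroWithin-++ (c ∷ v) (Y ++ W)))
  ∷ zeroWithin-sufs v Y W (≤-trans (n≤1+n _) c∷v≤n) zY

module _ (f : Str → Bool) where

  count-sufs-++ : ∀ u Y → count f (sufs (u ++ Y)) ≡ count f (map (_++ Y) (sufs u)) + count f (sufs Y)
  count-sufs-++ u Y = trans (cong (count f) (sufs-++ u Y)) (count-++ f (map (_++ Y) (sufs u)) (sufs Y))

  count-sufs-pow : ∀ {U c} → (∀ W → count f (map (_++ W) (sufs U)) ≡ c) →
                   ∀ n Y → count f (sufs (pow U n ++ Y)) ≡ n * c + count f (sufs Y)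
  count-sufs-pow         per-U zero    Y = refl
  count-sufs-pow {U} {c} per-U (suc n) Y = begin
    count f (sufs ((U ++ pow U n) ++ Y))                                    ≡⟨ cong (count f ∘ sufs) (++-assoc U (pow U n) Y) ⟩
    count f (sufs (U ++ pow U n ++ Y))                                      ≡⟨ count-sufs-++ U (pow U n ++ Y) ⟩
    count f (map (_++ (pow U n ++ Y)) (sufs U)) + count f (sufs (pow U n ++ Y)) ≡⟨ cong₂ _+_ (per-U _) (count-sufs-pow per-U n Y) ⟩
    c + (n * c + count f (sufs Y))                                          ≡⟨ +-assoc c (n * c) _ ⟨
    suc n * c + count f (sufs Y)                                            ∎
    where open ≡-Reasoning

  count-sufs-concat : ∀ (blk : ℕ → Str) (c : ℕ → ℕ) {bs} →
                      All (λ b → ∀ Y → count f (sufs (blk b ++ Y)) ≡ c b + count f (sufs Y)) bs →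
                      count f (sufs (concat (map blk bs))) ≡ sum (map c bs)
  count-sufs-concat blk c []                  = refl
  count-sufs-concat blk c {b ∷ _} (per-b ∷ per-bs) = trans (per-b _) (cong (_+_ (c b)) (count-sufs-concat blk c per-bs))

module _ {P : Str → Set} where

  All-sufs-++ : ∀ u {Y} → All P (map (_++ Y) (sufs u)) → All P (sufs Y) → All P (sufs (u ++ Y))
  All-sufs-++ u {Y} Pu PY = subst (All P) (sym (sufs-++ u Y)) (++⁺ Pu PY)

  All-sufs-pow : ∀ {U} → (∀ W → All P (map (_++ W) (sufs U))) → ∀ n {Y} → All P (sufs Y) → All P (sufs (pow U n ++ Y))
  All-sufs-pow     per-U zero        PY = PY
  All-sufs-pow {U} per-U (suc n) {Y} PY =
    subst (All P ∘ sufs) (sym (++-assoc U (pow U n) Y)) (All-sufs-++ U (per-U _) (All-sufs-pow per-U n PY))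

  All-sufs-concat : ∀ (blk : ℕ → Str) {bs} → All (λ b → ∀ {Y} → All P (sufs Y) → All P (sufs (blk b ++ Y))) bs →
                    All P (sufs (concat (map blk bs)))
  All-sufs-concat blk []               = []
  All-sufs-concat blk (per-b ∷ per-bs) = per-b (All-sufs-concat blk per-bs)

-- Positions in lists

≡ᵇ-refl : ∀ n → (n ≡ᵇ n) ≡ true
≡ᵇ-refl n = dec-true (n ≟ n) refl

≢⇒≡ᵇ-false : ∀ {m n} → m ≢ n → (m ≡ᵇ n) ≡ false
≢⇒≡ᵇ-false {m} {n} = dec-false (m ≟ n)

∈-tail : ∀ {A : Set} {x y : A} {ys} → x ∈ y ∷ ys → y ≢ x → x ∈ ys
∈-tail (here refl) y≢x = ⊥-elim (y≢x refl)
∈-tail (there x∈)  _   = x∈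

at-∈ : ∀ (L : List ℕ) {r} → r < length L → at L (suc r) ∈ L
at-∈ (y ∷ ys) {zero}  _   = here refl
at-∈ (y ∷ ys) {suc r} r<L = there (at-∈ ys (s≤s⁻¹ r<L))

indexOf-head : ∀ x ys → indexOf (x ∷ ys) x ≡ 1
indexOf-head x ys rewrite ≡ᵇ-refl x = refl

indexOf-∈ : ∀ {L x} → x ∈ L → ∃[ c ] (indexOf L x ≡ suc c × c < length L)
indexOf-∈ {y ∷ ys} {x} x∈ with y ≟ x
... | yes refl = 0 , indexOf-head x ys , z<s
... | no y≢x rewrite ≢⇒≡ᵇ-false y≢x with c , eq , c<ys ← indexOf-∈ (∈-tail x∈ y≢x) rewrite eq =
  suc c , refl , s<s c<ys

indexOf-there : ∀ {y ys x} → y ≢ x → x ∈ ys → indexOf (y ∷ ys) x ≡ suc (indexOf ys x)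
indexOf-there y≢x x∈ rewrite ≢⇒≡ᵇ-false y≢x with c , eq , _ ← indexOf-∈ x∈ rewrite eq = refl

at-indexOf : ∀ {L x} → x ∈ L → at L (indexOf L x) ≡ x
at-indexOf {y ∷ ys} {x} x∈ with y ≟ x
... | yes refl rewrite indexOf-head x ys = refl
... | no y≢x rewrite indexOf-there y≢x (∈-tail x∈ y≢x)
    with c , eq , _ ← indexOf-∈ (∈-tail x∈ y≢x) | at-indexOf (∈-tail x∈ y≢x)
...   | at≡x rewrite eq = at≡x

indexOf-at : ∀ {L} → Unique L → ∀ {r} → r < length L → indexOf L (at L (suc r)) ≡ suc r
indexOf-at {y ∷ ys} _              {zero}  _   = indexOf-head y ys
indexOf-at {y ∷ ys} (y∉ys ∷ uniq) {suc r} r<L =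
  trans (indexOf-there (All.lookup y∉ys (at-∈ ys r<ys)) (at-∈ ys r<ys)) (cong suc (indexOf-at uniq r<ys))
  where r<ys = s≤s⁻¹ r<L

≡ᵇ-reflects-injective : ∀ (f : ℕ → ℕ) {x y} → (f y ≡ f x → y ≡ x) → (f y ≡ᵇ f x) ≡ (y ≡ᵇ x)
≡ᵇ-reflects-injective f {x} {y} f-inj with y ≟ x
... | yes refl = trans (≡ᵇ-refl (f x)) (sym (≡ᵇ-refl x))
... | no y≢x   = trans (≢⇒≡ᵇ-false (λ fy≡fx → y≢x (f-inj fy≡fx))) (sym (≢⇒≡ᵇ-false y≢x))

indexOf-map : ∀ (f : ℕ → ℕ) {L x} → (∀ {y} → y ∈ L → f y ≡ f x → y ≡ x) →
              indexOf (map f L) (f x) ≡ indexOf L x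
indexOf-map f {[]}     f-inj = refl
indexOf-map f {y ∷ ys} f-inj
  rewrite ≡ᵇ-reflects-injective f (f-inj (here refl)) | indexOf-map f {ys} (λ y∈ → f-inj (there y∈)) = refl

indexOf-sorted : ∀ (key : ℕ → Str) {L x} → AllPairs (λ u v → key u ≺ᵇ key v ≡ true) L → x ∈ L →
                 indexOf L x ≡ suc (count (λ y → key y ≺ᵇ key x) L)
indexOf-sorted key {y ∷ ys} {x} (y≺ys ∷ sorted) x∈ with y ≟ x
... | yes refl rewrite indexOf-head x ys | ≺ᵇ-irrefl (key x) =
  cong suc (sym (count-none (All.map (λ {z} x≺z → ≺ᵇ-asym (key x) (key z) x≺z) y≺ys)))
... | no y≢x rewrite indexOf-there y≢x (∈-tail x∈ y≢x) | All.lookup y≺ys (∈-tail x∈ y≢x) =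
  cong suc (indexOf-sorted key sorted (∈-tail x∈ y≢x))

-- Suffix arrays

module _ (S : Str) where

  private
    _≺ₛ_ : ℕ → ℕ → Set
    i ≺ₛ j = suffix S i ≺ᵇ suffix S j ≡ true

  insertPos-↭ : ∀ j L → insertPos S j L ↭ j ∷ L
  insertPos-↭ j []       = ↭-refl
  insertPos-↭ j (y ∷ ys) with suffix S j ≺ᵇ suffix S y
  ... | true  = ↭-refl
  ... | false = ↭-trans (↭-prep y (insertPos-↭ j ys)) (↭-swap y j ↭-refl)

  sortPos-↭ : ∀ L → sortPos S L ↭ L
  sortPos-↭ []       = ↭-refl
  sortPos-↭ (j ∷ js) = ↭-trans (insertPos-↭ j (sortPos S js)) (↭-prep j (sortPos-↭ js))

  insertPos-sorted : ∀ j {L} → AllPairs _≺ₛ_ L → All (λ y → suffix S j ≢ suffix S y) L →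
                     AllPairs _≺ₛ_ (insertPos S j L)
  insertPos-sorted j {[]}     []               []          = [] ∷ []
  insertPos-sorted j {y ∷ ys} (y≺ys ∷ sorted) (j≢y ∷ j≢ys) with suffix S j ≺ᵇ suffix S y in j≺y
  ... | true  = (j≺y ∷ All.map (λ {z} → ≺ᵇ-trans (suffix S j) (suffix S y) (suffix S z) j≺y) y≺ys) ∷ y≺ys ∷ sorted
  ... | false = All-resp-↭ (↭-sym (insertPos-↭ j ys)) (≺ᵇ-connex (suffix S j) (suffix S y) j≢y j≺y ∷ y≺ys)
              ∷ insertPos-sorted j sorted j≢ys

  sortPos-sorted : ∀ {L} → AllPairs (λ i j → suffix S i ≢ suffix S j) L → AllPairs _≺ₛ_ (sortPos S L)
  sortPos-sorted {[]}     []                = []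
  sortPos-sorted {j ∷ js} (j≢js ∷ distinct) =
    insertPos-sorted j (sortPos-sorted distinct) (All-resp-↭ (↭-sym (sortPos-↭ js)) j≢js)

cyclicPred : ℕ → ℕ → ℕ
cyclicPred N p = if p ≡ᵇ 1 then N else p ∸ 1

cyclicPred-∈ : ∀ {N p} → p ∈ range1 N → cyclicPred N p ∈ range1 N
cyclicPred-∈ {suc N} {p} p∈ with ∈-range1⁻ p∈
... | zero  , refl , _         = ∈-range1⁺ (n<1+n N)
... | suc i , refl , suc-i<1+N = ∈-range1⁺ (m<n⇒m<1+n (s≤s⁻¹ suc-i<1+N))

cyclicPred-injective : ∀ {N p p′} → p ∈ range1 N → p′ ∈ range1 N → cyclicPred N p ≡ cyclicPred N p′ → p ≡ p′
cyclicPred-injective p∈ p′∈ eq with ∈-range1⁻ p∈ | ∈-range1⁻ p′∈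
... | zero  , refl , _   | zero   , refl , _    = refl
... | suc i , refl , _   | suc i′ , refl , _    = cong suc eq
... | zero  , refl , _   | suc i′ , refl , i′<N = ⊥-elim (<-irrefl (sym eq) i′<N)
... | suc i , refl , i<N | zero   , refl , _    = ⊥-elim (<-irrefl eq i<N)

module SuffixArray (S : Str) where

  N : ℕ
  N = length S

  private
    L : List ℕ
    L = SAlist S

  suffixes-distinct : AllPairs (λ i j → suffix S i ≢ suffix S j) (range1 N)
  suffixes-distinct = subst (AllPairs _) (sym (range1-applyUpTo N))
    (AllPairsₚ.map⁻ (subst Unique (sym (map-applyUpTo suc (suffix S) N))
      (Unique.applyUpTo⁺₁ (λ i → drop i S) N drop-distinct)))
    where
    drop-distinct : ∀ {i j} → i < j → j < N → drop i S ≢ drop j S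
    drop-distinct {i} {j} i<j j<N eq = <⇒≢ i<j (∸-cancelˡ-≡ (<⇒≤ (<-trans i<j j<N)) (<⇒≤ j<N)
      (trans (sym (length-drop i S)) (trans (cong length eq) (length-drop j S))))

  SAlist-↭ : L ↭ range1 N
  SAlist-↭ = sortPos-↭ S (range1 N)

  SAlist-sorted : AllPairs (λ i j → suffix S i ≺ᵇ suffix S j ≡ true) L
  SAlist-sorted = sortPos-sorted S suffixes-distinct

  SAlist-unique : Unique L
  SAlist-unique = AllPairs.map ≺⇒≢ SAlist-sorted
    where
    ≺⇒≢ : ∀ {i j} → suffix S i ≺ᵇ suffix S j ≡ true → i ≢ j
    ≺⇒≢ {i} i≺i refl with () ← trans (sym i≺i) (≺ᵇ-irrefl (suffix S i))

  length-SAlist : length L ≡ N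
  length-SAlist = trans (↭-length SAlist-↭) (trans (length-map suc (upTo N)) (length-upTo N))

  private
    ∈L⇒∈range : ∀ {j} → j ∈ L → j ∈ range1 N
    ∈L⇒∈range = ∈-resp-↭ SAlist-↭

    ∈range⇒∈L : ∀ {j} → j ∈ range1 N → j ∈ L
    ∈range⇒∈L = ∈-resp-↭ (↭-sym SAlist-↭)

    <N⇒<length : ∀ {r} → r < N → r < length L
    <N⇒<length = subst (_ <_) (sym length-SAlist)

  SA-∈ : ∀ {i} → i ∈ range1 N → SA S i ∈ range1 N
  SA-∈ i∈ with r , refl , r<N ← ∈-range1⁻ i∈ = ∈L⇒∈range (at-∈ L (<N⇒<length r<N))

  ISA-∈ : ∀ {j} → j ∈ range1 N → ISA S j ∈ range1 N
  ISA-∈ j∈ with c , eq , c<L ← indexOf-∈ (∈range⇒∈L j∈) rewrite eq = ∈-range1⁺ (subst (_ <_) length-SAlist c<L)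

  ISA-SA : ∀ {i} → i ∈ range1 N → ISA S (SA S i) ≡ i
  ISA-SA i∈ with r , refl , r<N ← ∈-range1⁻ i∈ = indexOf-at SAlist-unique (<N⇒<length r<N)

  SA-ISA : ∀ {j} → j ∈ range1 N → SA S (ISA S j) ≡ j
  SA-ISA j∈ = at-indexOf (∈range⇒∈L j∈)

  ISA-rank : ∀ {j} → j ∈ range1 N → ISA S j ≡ suc (rank S (suffix S j))
  ISA-rank {j} j∈ = begin
    ISA S j                                                   ≡⟨ indexOf-sorted (suffix S) SAlist-sorted (∈range⇒∈L j∈) ⟩
    suc (count (λ i → suffix S i ≺ᵇ suffix S j) L)            ≡⟨ cong suc (count-↭ _ SAlist-↭) ⟩
    suc (count (λ i → suffix S i ≺ᵇ suffix S j) (range1 N))   ≡⟨ cong suc (count-map (_≺ᵇ suffix S j) (suffix S) (range1 N)) ⟨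
    suc (count (_≺ᵇ suffix S j) (map (suffix S) (range1 N))) ≡⟨ cong (suc ∘ count (_≺ᵇ suffix S j)) (map-suffix-range1 S) ⟩
    suc (rank S (suffix S j))                                 ∎
    where open ≡-Reasoning

  LF-cyclicPred : ∀ i → LF S i ≡ ISA S (cyclicPred N (SA S i))
  LF-cyclicPred i = sym (if-float (ISA S) (SA S i ≡ᵇ 1))

  LF-injective : ∀ {i j} → i ∈ range1 N → j ∈ range1 N → LF S i ≡ LF S j → i ≡ j
  LF-injective {i} {j} i∈ j∈ eq = begin
    i                ≡⟨ ISA-SA i∈ ⟨
    ISA S (SA S i)   ≡⟨ cong (ISA S) SA-i≡SA-j ⟩
    ISA S (SA S j)   ≡⟨ ISA-SA j∈ ⟩
    j                ∎
    where
    open ≡-Reasoning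
    pred-i∈ = cyclicPred-∈ (SA-∈ i∈)
    pred-j∈ = cyclicPred-∈ (SA-∈ j∈)
    SA-i≡SA-j : SA S i ≡ SA S j
    SA-i≡SA-j = cyclicPred-injective (SA-∈ i∈) (SA-∈ j∈)
      (begin
        cyclicPred N (SA S i)                ≡⟨ SA-ISA pred-i∈ ⟨
        SA S (ISA S (cyclicPred N (SA S i))) ≡⟨ cong (SA S) (trans (sym (LF-cyclicPred i)) (trans eq (LF-cyclicPred j))) ⟩
        SA S (ISA S (cyclicPred N (SA S j))) ≡⟨ SA-ISA pred-j∈ ⟩
        cyclicPred N (SA S j)                ∎)

  LFinv-LF : ∀ {i} → i ∈ range1 N → LFinv S (LF S i) ≡ i
  LFinv-LF {i} i∈ = begin
    at (range1 N) (indexOf (map (LF S) (range1 N)) (LF S i)) ≡⟨ cong (at (range1 N)) (indexOf-map (LF S) (λ j∈ → LF-injective j∈ i∈)) ⟩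
    at (range1 N) (indexOf (range1 N) i)                     ≡⟨ at-indexOf i∈ ⟩
    i                                                        ∎
    where open ≡-Reasoning

  LFinv-ISA : ∀ {q} → 1 ≤ q → q < N → LFinv S (ISA S q) ≡ ISA S (suc q)
  LFinv-ISA {suc q} _ q<N = begin
    LFinv S (ISA S (suc q))                     ≡⟨ cong (LFinv S ∘ ISA S ∘ cyclicPred N) (SA-ISA q+1∈) ⟨
    LFinv S (ISA S (cyclicPred N (SA S j)))     ≡⟨ cong (LFinv S) (LF-cyclicPred j) ⟨
    LFinv S (LF S j)                            ≡⟨ LFinv-LF (ISA-∈ q+1∈) ⟩
    j                                           ∎
    where
    open ≡-Reasoning
    q+1∈ = ∈-range1⁺ q<N
    j = ISA S (suc (suc q))

  private
    next-suffix : ∀ q {c y t} → suffix S (suc q) ≡ c ∷ y ∷ t → suc q < N × suffix S (suc (suc q)) ≡ y ∷ t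
    next-suffix q eq = drop-≡-∷⇒< (suc q) S (suffix-suc S q eq) , suffix-suc S q eq

  suffix-tail-∈ : ∀ {q c y t} → q ∈ range1 N → suffix S q ≡ c ∷ y ∷ t → y ∷ t ∈ sufs S
  suffix-tail-∈ q∈ eq with q′ , refl , _ ← ∈-range1⁻ q∈ with q+1<N , next ← next-suffix q′ eq =
    subst (_∈ sufs S) next (suffix-∈-sufs S (∈-range1⁺ q+1<N))

  LFinv-ISA-tail : ∀ {q c y t} → q ∈ range1 N → suffix S q ≡ c ∷ y ∷ t → LFinv S (ISA S q) ≡ suc (rank S (y ∷ t))
  LFinv-ISA-tail q∈ eq with q′ , refl , _ ← ∈-range1⁻ q∈ with q+1<N , next ← next-suffix q′ eq =
    trans (LFinv-ISA (s≤s z≤n) q+1<N) (trans (ISA-rank (∈-range1⁺ q+1<N)) (cong (suc ∘ rank S) next))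

-- Arithmetic

<ᵇ-true : ∀ {m n} → m < n → (m <ᵇ n) ≡ true
<ᵇ-true {m} {n} = dec-true (m <? n)

<ᵇ-false : ∀ {m n} → n ≤ m → (m <ᵇ n) ≡ false
<ᵇ-false {m} {n} n≤m = dec-false (m <? n) (≤⇒≯ n≤m)

<ᵇ≡true⇒< : ∀ {m n} → (m <ᵇ n) ≡ true → m < n
<ᵇ≡true⇒< {m} {n} m<ᵇn = <ᵇ⇒< m n (subst Bool.T (sym m<ᵇn) _)

sum-applyUpTo-const : ∀ c n → sum (applyUpTo (λ _ → c) n) ≡ n * c
sum-applyUpTo-const c zero    = refl
sum-applyUpTo-const c (suc n) = cong (_+_ c) (sum-applyUpTo-const c n)

sum-applyUpTo-<ᵇ : ∀ (g : ℕ → ℕ) {i n} → i ≤ n →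
                   sum (applyUpTo (λ b → if b <ᵇ i then g b else 0) n) ≡ sum (applyUpTo g i)
sum-applyUpTo-<ᵇ g {zero}  {n}     _         = trans (sum-applyUpTo-const 0 n) (*-zeroʳ n)
sum-applyUpTo-<ᵇ g {suc i} {suc n} (s≤s i≤n) = cong (_+_ (g 0)) (sum-applyUpTo-<ᵇ (g ∘ suc) i≤n)

sum-applyUpTo-differences : ∀ (A : ℕ → ℕ) n → (∀ {b} → b < n → A b ≤ A (suc b)) →
                            sum (applyUpTo (λ b → A (suc b) ∸ A b) n) + A 0 ≡ A n
sum-applyUpTo-differences A zero    _    = refl
sum-applyUpTo-differences A (suc n) step = begin
  (A 1 ∸ A 0) + rest + A 0   ≡⟨ cong (_+ A 0) (+-comm (A 1 ∸ A 0) rest) ⟩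
  rest + (A 1 ∸ A 0) + A 0   ≡⟨ +-assoc rest (A 1 ∸ A 0) (A 0) ⟩
  rest + ((A 1 ∸ A 0) + A 0) ≡⟨ cong (_+_ rest) (m∸n+n≡m (step z<s)) ⟩
  rest + A 1                 ≡⟨ sum-applyUpTo-differences (A ∘ suc) n (λ b<n → step (s<s b<n)) ⟩
  A (suc n)                  ∎
  where
  open ≡-Reasoning
  rest = sum (applyUpTo (λ b → A (suc (suc b)) ∸ A (suc b)) n)

stepwise-mono : ∀ (f : ℕ → ℕ) {n} → (∀ {i} → i < n → f i ≤ f (suc i)) → ∀ {i j} → i ≤ j → j ≤ n → f i ≤ f j
stepwise-mono f step {j = zero}  z≤n _ = ≤-refl
stepwise-mono f step {j = suc j} i≤1+j 1+j≤n with m≤n⇒m<n∨m≡n i≤1+j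
... | inj₂ refl  = ≤-refl
... | inj₁ i<1+j = ≤-trans (stepwise-mono f step (s≤s⁻¹ i<1+j) (<⇒≤ 1+j≤n)) (step 1+j≤n)

/-unique : ∀ {t q n} .{{_ : NonZero n}} → q * n ≤ t → t < suc q * n → t / n ≡ q
/-unique {t} {q} {n} lo hi = ≤-antisym (s≤s⁻¹ (m<n*o⇒m/o<n hi)) (subst (_≤ t / n) (m*n/n≡m q n) (/-monoˡ-≤ n lo))

ceilDiv-suc : ∀ {n b D} → 0 < n → b * n ≤ D → D < suc b * n → ceilDiv (+ suc D) n ≡ + suc b
ceilDiv-suc {suc n} {b} {D} _ lo hi = cong +_ (/-unique (subst (suc b * suc n ≤_) n+1+D≡1+D+n (+-monoʳ-≤ (suc n) lo))
                                                        (subst (_< suc (suc b) * suc n) n+1+D≡1+D+n (+-monoʳ-< (suc n) hi)))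
  where
  n+1+D≡1+D+n : suc n + D ≡ suc D + n
  n+1+D≡1+D+n = cong suc (+-comm n D)

+[m+n]-+m : ∀ m n → + (m + n) ℤ.- + m ≡ + n
+[m+n]-+m m n = trans ([+m]-[+n]≡m⊖n (m + n) m) (trans (⊖-≥ (m≤m+n m n)) (cong +_ (m+n∸m≡n m n)))

-- Binary representations

<2^1+⌊log₂⌋ : ∀ m → m < 2 ^ (1 + ⌊log₂ m ⌋)
<2^1+⌊log₂⌋ m with m <? 2 ^ (1 + ⌊log₂ m ⌋)
... | yes m<2^ = m<2^
... | no  m≮2^ = contradiction (subst (_≤ ⌊log₂ m ⌋) (⌊log₂[2^n]⌋≡n (1 + ⌊log₂ m ⌋)) (⌊log₂⌋-mono-≤ (≮⇒≥ m≮2^)))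
                               (1+n≰n {⌊log₂ m ⌋})

length-bin : ∀ k x → length (bin k x) ≡ k
length-bin zero    x = refl
length-bin (suc k) x = trans (length-++ (bin k (x / 2))) (trans (cong (_+ 1) (length-bin k (x / 2))) (+-comm k 1))

equal-halves⇒parities : ∀ {x y} → x / 2 ≡ y / 2 → x < y → x % 2 ≡ 0 × y % 2 ≡ 1
equal-halves⇒parities {x} {y} halves x<y = parities (x % 2) (y % 2) (m%n<n x 2) (m%n<n y 2) x%2<y%2
  where
  x%2<y%2 : x % 2 < y % 2
  x%2<y%2 = +-cancelʳ-< (y / 2 * 2) (x % 2) (y % 2)
    (subst₂ _<_ (trans (m≡m%n+[m/n]*n x 2) (cong (λ h → x % 2 + h * 2) halves)) (m≡m%n+[m/n]*n y 2) x<y)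
  parities : ∀ a b → a < 2 → b < 2 → a < b → a ≡ 0 × b ≡ 1
  parities 0 1 _ _ _ = refl , refl
  parities 0 0 _ _ ()
  parities 1 1 _ _ (s≤s ())
  parities 1 0 _ _ ()
  parities (suc (suc _)) _ (s≤s (s≤s ())) _ _
  parities _ (suc (suc _)) _ (s≤s (s≤s ())) _

bin-≺ᵇ : ∀ k {x y} X Y → x < y → y < 2 ^ k → (bin k x ++ X) ≺ᵇ (bin k y ++ Y) ≡ true
bin-≺ᵇ zero    X Y x<y (s≤s z≤n) = contradiction x<y n≮0
bin-≺ᵇ (suc k) {x} {y} X Y x<y y<2^k+1
  rewrite ++-assoc (bin k (x / 2)) ((x % 2 ≡ᵇ 1) ∷ []) X | ++-assoc (bin k (y / 2)) ((y % 2 ≡ᵇ 1) ∷ []) Y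
  with <-cmp (x / 2) (y / 2)
... | tri< x/2<y/2 _ _ = bin-≺ᵇ k _ _ x/2<y/2 (m<n*o⇒m/o<n (subst (y <_) (*-comm 2 (2 ^ k)) y<2^k+1))
... | tri> _ _ x/2>y/2 = contradiction (/-monoˡ-≤ 2 (<⇒≤ x<y)) (<⇒≱ x/2>y/2)
... | tri≈ _ halves _ with equal-halves⇒parities halves x<y
...   | x%2≡0 , y%2≡1 rewrite halves | ≺ᵇ-cancelˡ (bin k (y / 2)) ((x % 2 ≡ᵇ 1) ∷ X) ((y % 2 ≡ᵇ 1) ∷ Y)
                             | x%2≡0 | y%2≡1 = refl

module _ (k : ℕ) {b i} (b<2^k : b < 2 ^ k) (i<2^k : i < 2 ^ k) where

  bin-0-≺ᵇ-bin : ∀ Z → (bin k b ++ false ∷ Z) ≺ᵇ bin k i ≡ (b <ᵇ i)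
  bin-0-≺ᵇ-bin Z with <-cmp b i
  ... | tri< b<i _ _ = trans (subst (λ w → (bin k b ++ false ∷ Z) ≺ᵇ w ≡ true) (++-identityʳ (bin k i))
                                    (bin-≺ᵇ k (false ∷ Z) [] b<i i<2^k))
                             (sym (<ᵇ-true b<i))
  ... | tri≈ _ refl _ = trans (++-⊀ᵇ (bin k b) (false ∷ Z)) (sym (<ᵇ-false (≤-refl {b})))
  ... | tri> _ _ i<b = trans (≺ᵇ-asym (bin k i) _ (subst (λ w → w ≺ᵇ (bin k b ++ false ∷ Z) ≡ true) (++-identityʳ (bin k i))
                                                       (bin-≺ᵇ k [] (false ∷ Z) i<b b<2^k)))
                             (sym (<ᵇ-false (<⇒≤ i<b)))

  bin-0-≺ᵇ-bin-1 : ∀ Z → (bin k b ++ false ∷ Z) ≺ᵇ (bin k i ++ true ∷ []) ≡ (b <ᵇ suc i)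
  bin-0-≺ᵇ-bin-1 Z with <-cmp b i
  ... | tri< b<i _ _ = trans (bin-≺ᵇ k (false ∷ Z) (true ∷ []) b<i i<2^k) (sym (<ᵇ-true (m<n⇒m<1+n b<i)))
  ... | tri≈ _ refl _ = trans (≺ᵇ-cancelˡ (bin k b) (false ∷ Z) (true ∷ [])) (sym (<ᵇ-true (n<1+n b)))
  ... | tri> _ _ i<b = trans (≺ᵇ-asym (bin k i ++ true ∷ []) (bin k b ++ false ∷ Z) (bin-≺ᵇ k (true ∷ []) (false ∷ Z) i<b b<2^k))
                             (sym (<ᵇ-false i<b))

-- The text T

module Construction (m k : ℕ) (A : ℕ → ℕ) (m<2^k : m < 2 ^ k) (A-zero : A 0 ≡ 0)
            (A-mono : ∀ {i j} → i ≤ j → j ≤ suc m → A i ≤ A j) (A-last : A (suc m) ≡ m * m) where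

  m² : ℕ
  m² = m * m

  d : ℕ → ℕ
  d b = A (suc b) ∸ A b

  E : ℕ → Str
  E = ebin k

  -- Tstr m k A unfolds definitionally to concat (map block (upTo (suc m))).
  block : ℕ → Str
  block b = pow (true ∷ E b) (d b) ++ pow (E b) (m² ∸ d b)

  T : Str
  T = Tstr m k A

  open SuffixArray T

  P₁ P₂ : Str
  P₁ = replicate (1 + k) true ++ false ∷ []
  P₂ = replicate (2 + k) true ++ false ∷ []

  α β : ℕ
  α = rank T P₂
  β = rank T P₁

  private
    <2^k : ∀ {b} → b ≤ m → b < 2 ^ k
    <2^k b≤m = ≤-<-trans b≤m m<2^k

  E-++ : ∀ b Z → E b ++ Z ≡ replicate (1 + k) true ++ false ∷ bin k b ++ false ∷ Z
  E-++ b Z = trans (++-assoc (replicate (1 + k) true) (false ∷ bin k b ++ false ∷ []) Z)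
                   (cong (λ w → replicate (1 + k) true ++ false ∷ w) (++-assoc (bin k b) (false ∷ []) Z))

  P₁-++ : ∀ X → P₁ ++ X ≡ replicate (1 + k) true ++ false ∷ X
  P₁-++ = ++-assoc (replicate (1 + k) true) (false ∷ [])

  E≡P₁++ : ∀ b Z → E b ++ Z ≡ P₁ ++ bin k b ++ false ∷ Z
  E≡P₁++ b Z = trans (E-++ b Z) (sym (P₁-++ (bin k b ++ false ∷ Z)))

  d≤m² : ∀ {b} → b ≤ m → d b ≤ m²
  d≤m² {b} b≤m = ≤-trans (m∸n≤m (A (suc b)) (A b)) (subst (A (suc b) ≤_) A-last (A-mono (s≤s b≤m) ≤-refl))

  sum-d : ∀ {i} → i ≤ suc m → sum (applyUpTo d i) ≡ A i
  sum-d {i} i≤1+m = begin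
    sum (applyUpTo d i)       ≡⟨ +-identityʳ _ ⟨
    sum (applyUpTo d i) + 0   ≡⟨ cong (_+_ (sum (applyUpTo d i))) A-zero ⟨
    sum (applyUpTo d i) + A 0 ≡⟨ sum-applyUpTo-differences A i (λ b<i → A-mono (n≤1+n _) (≤-trans b<i i≤1+m)) ⟩
    A i                       ∎
    where open ≡-Reasoning

  data Shape : Str → Set where
    junk   : ∀ {t} → ZeroWithin (suc k) t → Shape t
    plain  : ∀ {b} Z → b ≤ m → Shape (E b ++ Z)
    marked : ∀ {b} Z → b ≤ m → Shape (true ∷ E b ++ Z)

  unit-tail-junk : ∀ b W → All (ZeroWithin (suc k)) (map (_++ W) (sufs (replicate k true ++ false ∷ bin k b ++ false ∷ [])))
  unit-tail-junk b W = zeroWithin-sufs (replicate k true) (bin k b ++ false ∷ []) W (≤-reflexive (length-replicate k))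
                         (zeroWithin-sufs (bin k b) [] W (≤-reflexive (length-bin k b)) [])

  sufs-T-shapes : All Shape (sufs T)
  sufs-T-shapes = All-sufs-concat block (applyUpTo⁺₁ id (suc m) block-shapes)
    where
    block-shapes : ∀ {b} → b < suc m → ∀ {Y} → All Shape (sufs Y) → All Shape (sufs (block b ++ Y))
    block-shapes {b} (s≤s b≤m) {Y} shapes-Y =
      subst (All Shape ∘ sufs) (sym (++-assoc (pow (true ∷ E b) (d b)) (pow (E b) (m² ∸ d b)) Y))
        (All-sufs-pow marked-unit (d b) (All-sufs-pow plain-unit (m² ∸ d b) shapes-Y))
      where
      plain-unit : ∀ W → All Shape (map (_++ W) (sufs (E b)))
      plain-unit W = plain W b≤m ∷ All.map junk (unit-tail-junk b W)
      marked-unit : ∀ W → All Shape (map (_++ W) (sufs (true ∷ E b)))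
      marked-unit W = marked W b≤m ∷ plain-unit W

  module _ {f : Str → Bool} (f-junk : ∀ {t} → ZeroWithin (suc k) t → f t ≡ false) where

    private
      count-plain-unit : ∀ b W → count f (map (_++ W) (sufs (E b))) ≡ count f [ E b ++ W ]
      count-plain-unit b W = begin
        count f ([ E b ++ W ] ++ tail)           ≡⟨ count-++ f [ E b ++ W ] tail ⟩
        count f [ E b ++ W ] + count f tail      ≡⟨ cong (_+_ (count f [ E b ++ W ])) (count-none (All.map f-junk (unit-tail-junk b W))) ⟩
        count f [ E b ++ W ] + 0                 ≡⟨ +-identityʳ _ ⟩
        count f [ E b ++ W ]                     ∎
        where
        open ≡-Reasoning
        tail = map (_++ W) (sufs (replicate k true ++ false ∷ bin k b ++ false ∷ []))

      count-block : ∀ b {cM cP} → (∀ W → count f [ true ∷ E b ++ W ] ≡ cM) → (∀ W → count f [ E b ++ W ] ≡ cP) →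
                    ∀ Y → count f (sufs (block b ++ Y)) ≡ (d b * (cM + cP) + (m² ∸ d b) * cP) + count f (sufs Y)
      count-block b {cM} {cP} count-marked count-plain Y = begin
        count f (sufs ((marked-part ++ plain-part) ++ Y))                    ≡⟨ cong (count f ∘ sufs) (++-assoc marked-part plain-part Y) ⟩
        count f (sufs (marked-part ++ plain-part ++ Y))                      ≡⟨ count-sufs-pow f per-marked-unit (d b) (plain-part ++ Y) ⟩
        d b * (cM + cP) + count f (sufs (plain-part ++ Y))                   ≡⟨ cong (_+_ (d b * (cM + cP))) (count-sufs-pow f per-plain-unit (m² ∸ d b) Y) ⟩
        d b * (cM + cP) + ((m² ∸ d b) * cP + count f (sufs Y))               ≡⟨ +-assoc (d b * (cM + cP)) _ _ ⟨
        (d b * (cM + cP) + (m² ∸ d b) * cP) + count f (sufs Y)               ∎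
        where
        open ≡-Reasoning
        marked-part = pow (true ∷ E b) (d b)
        plain-part  = pow (E b) (m² ∸ d b)
        per-plain-unit : ∀ W → count f (map (_++ W) (sufs (E b))) ≡ cP
        per-plain-unit W = trans (count-plain-unit b W) (count-plain W)
        per-marked-unit : ∀ W → count f (map (_++ W) (sufs (true ∷ E b))) ≡ cM + cP
        per-marked-unit W = trans (count-++ f [ true ∷ E b ++ W ] _) (cong₂ _+_ (count-marked W) (per-plain-unit W))

      count-T : ∀ (c : ℕ → ℕ) → (∀ {b} → b ≤ m → ∀ Y → count f (sufs (block b ++ Y)) ≡ c b + count f (sufs Y)) →
                count f (sufs T) ≡ sum (applyUpTo c (suc m))
      count-T c per-block = trans (count-sufs-concat f block c (applyUpTo⁺₁ id (suc m) (λ {b} b<1+m → per-block (s≤s⁻¹ b<1+m))))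
                                  (cong sum (map-upTo c (suc m)))

    count-marked : ∀ {i} → i ≤ suc m → (∀ {b} Z → b ≤ m → f (E b ++ Z) ≡ false) →
                   (∀ {b} Z → b ≤ m → f (true ∷ E b ++ Z) ≡ (b <ᵇ i)) → count f (sufs T) ≡ A i
    count-marked {i} i≤1+m f-plain f-marked = begin
      count f (sufs T)          ≡⟨ count-T c per-block ⟩
      sum (applyUpTo c (suc m)) ≡⟨ sum-applyUpTo-<ᵇ d i≤1+m ⟩
      sum (applyUpTo d i)       ≡⟨ sum-d i≤1+m ⟩
      A i                       ∎
      where
      open ≡-Reasoning
      c : ℕ → ℕ
      c b = if b <ᵇ i then d b else 0
      per-block : ∀ {b} → b ≤ m → ∀ Y → count f (sufs (block b ++ Y)) ≡ c b + count f (sufs Y)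
      per-block {b} b≤m Y with b <ᵇ i in b<ᵇi
      ... | true  = trans (count-block b (λ W → count-[x]-true f (trans (f-marked W b≤m) b<ᵇi))
                                         (λ W → count-[x]-false f (f-plain W b≤m)) Y)
                          (cong (_+ count f (sufs Y))
                                (trans (cong₂ _+_ (*-identityʳ (d b)) (*-zeroʳ (m² ∸ d b))) (+-identityʳ (d b))))
      ... | false = trans (count-block b (λ W → count-[x]-false f (trans (f-marked W b≤m) b<ᵇi))
                                         (λ W → count-[x]-false f (f-plain W b≤m)) Y)
                          (cong (_+ count f (sufs Y)) (cong₂ _+_ (*-zeroʳ (d b)) (*-zeroʳ (m² ∸ d b))))

    count-plain : ∀ {i} → i ≤ suc m → (∀ {b} Z → b ≤ m → f (true ∷ E b ++ Z) ≡ false) →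
                  (∀ {b} Z → b ≤ m → f (E b ++ Z) ≡ (b <ᵇ i)) → count f (sufs T) ≡ i * m²
    count-plain {i} i≤1+m f-marked f-plain = begin
      count f (sufs T)                   ≡⟨ count-T c per-block ⟩
      sum (applyUpTo c (suc m))          ≡⟨ sum-applyUpTo-<ᵇ (λ _ → m²) i≤1+m ⟩
      sum (applyUpTo (λ _ → m²) i)       ≡⟨ sum-applyUpTo-const m² i ⟩
      i * m²                             ∎
      where
      open ≡-Reasoning
      c : ℕ → ℕ
      c b = if b <ᵇ i then m² else 0
      per-block : ∀ {b} → b ≤ m → ∀ Y → count f (sufs (block b ++ Y)) ≡ c b + count f (sufs Y)
      per-block {b} b≤m Y with b <ᵇ i in b<ᵇi
      ... | true  = trans (count-block b (λ W → count-[x]-false f (f-marked W b≤m))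
                                         (λ W → count-[x]-true f (trans (f-plain W b≤m) b<ᵇi)) Y)
                          (cong (_+ count f (sufs Y))
                                (trans (cong₂ _+_ (*-identityʳ (d b)) (*-identityʳ (m² ∸ d b))) (m+[n∸m]≡n (d≤m² b≤m))))
      ... | false = trans (count-block b (λ W → count-[x]-false f (f-marked W b≤m))
                                         (λ W → count-[x]-false f (trans (f-plain W b≤m) b<ᵇi)) Y)
                          (cong (_+ count f (sufs Y)) (cong₂ _+_ (*-zeroʳ (d b)) (*-zeroʳ (m² ∸ d b))))

  junk-≺ᵇ-P₁ : ∀ {t} → ZeroWithin (suc k) t → t ≺ᵇ P₁ ≡ true
  junk-≺ᵇ-P₁ = zeroWithin-≺ᵇ (false ∷ [])

  junk-≺ᵇ-P₂ : ∀ {t} → ZeroWithin (suc k) t → t ≺ᵇ P₂ ≡ true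
  junk-≺ᵇ-P₂ t₀ = zeroWithin-≺ᵇ (false ∷ []) (zeroWithin-mono (n≤1+n _) t₀)

  plain-≺ᵇ-P₂ : ∀ b Z → (E b ++ Z) ≺ᵇ P₂ ≡ true
  plain-≺ᵇ-P₂ b Z = subst (λ w → w ≺ᵇ P₂ ≡ true) (sym (E-++ b Z)) (zeroWithin-≺ᵇ (false ∷ []) zero-within)
    where
    u = replicate (1 + k) true
    zero-within : ZeroWithin (2 + k) (u ++ false ∷ bin k b ++ false ∷ Z)
    zero-within = subst (λ n → ZeroWithin (suc n) (u ++ false ∷ bin k b ++ false ∷ Z)) (length-replicate (1 + k))
                        (zeroWithin-++ u (bin k b ++ false ∷ Z))

  plain-⊀ᵇ-P₁ : ∀ b Z → (E b ++ Z) ≺ᵇ P₁ ≡ false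
  plain-⊀ᵇ-P₁ b Z = subst (λ w → w ≺ᵇ P₁ ≡ false) (sym (E≡P₁++ b Z)) (++-⊀ᵇ P₁ (bin k b ++ false ∷ Z))

  marked-⊀ᵇ-P₂ : ∀ b Z → (true ∷ E b ++ Z) ≺ᵇ P₂ ≡ false
  marked-⊀ᵇ-P₂ b Z = plain-⊀ᵇ-P₁ b Z

  plain-≺ᵇ-P₁-++ : ∀ b Z X → (E b ++ Z) ≺ᵇ (P₁ ++ X) ≡ (bin k b ++ false ∷ Z) ≺ᵇ X
  plain-≺ᵇ-P₁-++ b Z X = subst (λ w → w ≺ᵇ (P₁ ++ X) ≡ (bin k b ++ false ∷ Z) ≺ᵇ X) (sym (E≡P₁++ b Z))
                                (≺ᵇ-cancelˡ P₁ (bin k b ++ false ∷ Z) X)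

  marked-≺ᵇ-P₂-++ : ∀ b Z X → (true ∷ E b ++ Z) ≺ᵇ (P₂ ++ X) ≡ (bin k b ++ false ∷ Z) ≺ᵇ X
  marked-≺ᵇ-P₂-++ b Z X = plain-≺ᵇ-P₁-++ b Z X

  marked-⊀ᵇ-P₁-++ : ∀ b Z X → (true ∷ E b ++ Z) ≺ᵇ (P₁ ++ X) ≡ false
  marked-⊀ᵇ-P₁-++ b Z X = subst₂ (λ u w → (true ∷ u) ≺ᵇ w ≡ false) (sym (E-++ b Z)) (sym (P₁-++ X))
                                 (1ⁿ⁺¹-⊀ᵇ-1ⁿ0 (1 + k) (false ∷ bin k b ++ false ∷ Z) X)

  rank-P₂-++ : ∀ X {i} → i ≤ suc m → (∀ {b} Z → b ≤ m → (bin k b ++ false ∷ Z) ≺ᵇ X ≡ (b <ᵇ i)) →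
               rank T (P₂ ++ X) ≡ α + A i
  rank-P₂-++ X {i} i≤1+m bin≺X = trans (count-split (λ t t≺P₂ → ≺ᵇ-++ʳ t P₂ X t≺P₂) (sufs T))
                                   (cong (_+_ α) (count-marked {f = f} f-junk i≤1+m f-plain f-marked))
    where
    f : Str → Bool
    f t = not (t ≺ᵇ P₂) ∧ t ≺ᵇ (P₂ ++ X)
    f-junk : ∀ {t} → ZeroWithin (suc k) t → f t ≡ false
    f-junk t₀ rewrite junk-≺ᵇ-P₂ t₀ = refl
    f-plain : ∀ {b} Z → b ≤ m → f (E b ++ Z) ≡ false
    f-plain {b} Z _ rewrite plain-≺ᵇ-P₂ b Z = refl
    f-marked : ∀ {b} Z → b ≤ m → f (true ∷ E b ++ Z) ≡ (b <ᵇ i)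
    f-marked {b} Z b≤m rewrite marked-⊀ᵇ-P₂ b Z = trans (marked-≺ᵇ-P₂-++ b Z X) (bin≺X Z b≤m)

  rank-P₁-++ : ∀ X {i} → i ≤ suc m → (∀ {b} Z → b ≤ m → (bin k b ++ false ∷ Z) ≺ᵇ X ≡ (b <ᵇ i)) →
               rank T (P₁ ++ X) ≡ β + i * m²
  rank-P₁-++ X {i} i≤1+m bin≺X = trans (count-split (λ t t≺P₁ → ≺ᵇ-++ʳ t P₁ X t≺P₁) (sufs T))
                                   (cong (_+_ β) (count-plain {f = f} f-junk i≤1+m f-marked f-plain))
    where
    f : Str → Bool
    f t = not (t ≺ᵇ P₁) ∧ t ≺ᵇ (P₁ ++ X)
    f-junk : ∀ {t} → ZeroWithin (suc k) t → f t ≡ false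
    f-junk t₀ rewrite junk-≺ᵇ-P₁ t₀ = refl
    f-marked : ∀ {b} Z → b ≤ m → f (true ∷ E b ++ Z) ≡ false
    f-marked {b} Z _ rewrite marked-⊀ᵇ-P₁-++ b Z X = ∧-zeroʳ _
    f-plain : ∀ {b} Z → b ≤ m → f (E b ++ Z) ≡ (b <ᵇ i)
    f-plain {b} Z b≤m rewrite plain-⊀ᵇ-P₁ b Z = trans (plain-≺ᵇ-P₁-++ b Z X) (bin≺X Z b≤m)

  α+m²≡length : α + m² ≡ length T
  α+m²≡length = begin
    α + m²                                          ≡⟨ cong (_+_ α) (trans (sym A-last) (sym count-marked-all)) ⟩
    α + count (not ∘ (_≺ᵇ P₂)) (sufs T)             ≡⟨ count-+-count-not (_≺ᵇ P₂) (sufs T) ⟩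
    length (sufs T)                                 ≡⟨ length-sufs T ⟩
    length T                                        ∎
    where
    open ≡-Reasoning
    count-marked-all : count (not ∘ (_≺ᵇ P₂)) (sufs T) ≡ A (suc m)
    count-marked-all = count-marked f-junk ≤-refl f-plain f-marked
      where
      f-junk : ∀ {t} → ZeroWithin (suc k) t → not (t ≺ᵇ P₂) ≡ false
      f-junk t₀ rewrite junk-≺ᵇ-P₂ t₀ = refl
      f-plain : ∀ {b} Z → b ≤ m → not ((E b ++ Z) ≺ᵇ P₂) ≡ false
      f-plain {b} Z _ rewrite plain-≺ᵇ-P₂ b Z = refl
      f-marked : ∀ {b} Z → b ≤ m → not ((true ∷ E b ++ Z) ≺ᵇ P₂) ≡ (b <ᵇ suc m)
      f-marked {b} Z b≤m rewrite marked-⊀ᵇ-P₂ b Z = sym (<ᵇ-true (s≤s b≤m))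

  rank-P₂-bin : ∀ {b} → b ≤ m → rank T (P₂ ++ bin k b) ≡ α + A b
  rank-P₂-bin {b} b≤m = rank-P₂-++ (bin k b) (m≤n⇒m≤1+n b≤m) (λ Z b′≤m → bin-0-≺ᵇ-bin k (<2^k b′≤m) (<2^k b≤m) Z)

  rank-P₂-bin-1 : ∀ {b} → b ≤ m → rank T (P₂ ++ bin k b ++ true ∷ []) ≡ α + A (suc b)
  rank-P₂-bin-1 {b} b≤m = rank-P₂-++ (bin k b ++ true ∷ []) (s≤s b≤m) (λ Z b′≤m → bin-0-≺ᵇ-bin-1 k (<2^k b′≤m) (<2^k b≤m) Z)

  rank-P₁-bin : ∀ {b} → b ≤ m → rank T (P₁ ++ bin k b) ≡ β + b * m²
  rank-P₁-bin {b} b≤m = rank-P₁-++ (bin k b) (m≤n⇒m≤1+n b≤m) (λ Z b′≤m → bin-0-≺ᵇ-bin k (<2^k b′≤m) (<2^k b≤m) Z)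

  rank-P₁-bin-1 : ∀ {b} → b ≤ m → rank T (P₁ ++ bin k b ++ true ∷ []) ≡ β + suc b * m²
  rank-P₁-bin-1 {b} b≤m = rank-P₁-++ (bin k b ++ true ∷ []) (s≤s b≤m) (λ Z b′≤m → bin-0-≺ᵇ-bin-1 k (<2^k b′≤m) (<2^k b≤m) Z)

  plain-rank : ∀ {b} Z → b ≤ m → E b ++ Z ∈ sufs T →
               ∃[ D ] (rank T (E b ++ Z) ≡ β + D × b * m² ≤ D × D < suc b * m²)
  plain-rank {b} Z b≤m s∈ = rank T s ∸ β , sym β+D≡rank
                          , +-cancelˡ-≤ β _ _ (subst (β + b * m² ≤_) (sym β+D≡rank) lower)
                          , +-cancelˡ-< β _ _ (subst (_< β + suc b * m²) (sym β+D≡rank) upper)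
    where
    s = E b ++ Z
    lower : β + b * m² ≤ rank T s
    lower = subst₂ _≤_ (rank-P₁-bin b≤m) (cong (rank T) (trans (++-assoc P₁ (bin k b) (false ∷ Z)) (sym (E≡P₁++ b Z))))
                   (rank-≤-++ T (P₁ ++ bin k b) (false ∷ Z))
    upper : rank T s < β + suc b * m²
    upper = subst (rank T s <_) (rank-P₁-bin-1 b≤m)
                  (rank-< T s∈ (trans (plain-≺ᵇ-P₁-++ b Z _) (trans (bin-0-≺ᵇ-bin-1 k (<2^k b≤m) (<2^k b≤m) Z) (<ᵇ-true (n<1+n b)))))
    β+D≡rank : β + (rank T s ∸ β) ≡ rank T s
    β+D≡rank = m+[n∸m]≡n (≤-trans (m≤m+n β _) lower)

  private
    ≮α : ∀ {s x} → rank T s ≡ α + x → ¬ rank T s < α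
    ≮α rank≡ = ≤⇒≯ (subst (α ≤_) (sym rank≡) (m≤m+n α _))

  marked-at-rank : ∀ {s x} → s ∈ sufs T → rank T s ≡ α + x → Shape s →
                   ∃[ b ] ∃[ Z ] (b ≤ m × s ≡ true ∷ E b ++ Z × A b ≤ x × x < A (suc b))
  marked-at-rank s∈ rank≡ (junk t₀)       = contradiction (rank-< T s∈ (junk-≺ᵇ-P₂ t₀)) (≮α rank≡)
  marked-at-rank s∈ rank≡ (plain {b} Z _) = contradiction (rank-< T s∈ (plain-≺ᵇ-P₂ b Z)) (≮α rank≡)
  marked-at-rank {x = x} s∈ rank≡ (marked {b} Z b≤m) =
    b , Z , b≤m , refl , +-cancelˡ-≤ α _ _ (subst (α + A b ≤_) rank≡ lower) , +-cancelˡ-< α _ _ (subst (_< α + A (suc b)) rank≡ upper)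
    where
    s = true ∷ E b ++ Z
    lower : α + A b ≤ rank T s
    lower = subst₂ _≤_ (rank-P₂-bin b≤m) (cong (rank T) (trans (++-assoc P₂ (bin k b) (false ∷ Z)) (sym (cong (true ∷_) (E≡P₁++ b Z)))))
                   (rank-≤-++ T (P₂ ++ bin k b) (false ∷ Z))
    upper : rank T s < α + A (suc b)
    upper = subst (rank T s <_) (rank-P₂-bin-1 b≤m)
                  (rank-< T s∈ (trans (marked-≺ᵇ-P₂-++ b Z _) (trans (bin-0-≺ᵇ-bin-1 k (<2^k b≤m) (<2^k b≤m) Z) (<ᵇ-true (n<1+n b)))))

  LFinv-marked : ∀ {q b Z} → q ∈ range1 (length T) → b ≤ m → suffix T q ≡ true ∷ E b ++ Z →
                 ∃[ D ] (LFinv T (ISA T q) ≡ suc (β + D) × b * m² ≤ D × D < suc b * m²)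
  LFinv-marked {b = b} {Z} q∈ b≤m suffix≡ with D , rank≡ , D-bounds ← plain-rank Z b≤m (suffix-tail-∈ q∈ suffix≡) =
    D , trans (LFinv-ISA-tail q∈ suffix≡) (cong suc rank≡) , D-bounds

  LFinv-at-rank : ∀ {q x} → q ∈ range1 (length T) → ISA T q ≡ suc (α + x) →
                  ∃[ b ] (b ≤ m × A b ≤ x × x < A (suc b) ×
                          ∃[ D ] (LFinv T (suc (α + x)) ≡ suc (β + D) × b * m² ≤ D × D < suc b * m²))
  LFinv-at-rank q∈ ISA≡
    with b , Z , b≤m , suffix≡ , A-lower , A-upper ← marked-at-rank (suffix-∈-sufs T q∈) (suc-injective (trans (sym (ISA-rank q∈)) ISA≡))
                                                           (All.lookup sufs-T-shapes (suffix-∈-sufs T q∈))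
    with D , LFinv≡ , D-bounds ← LFinv-marked q∈ b≤m suffix≡ =
    b , b≤m , A-lower , A-upper , D , trans (cong (LFinv T) (sym ISA≡)) LFinv≡ , D-bounds

  LFinv-α+x : ∀ {x} → x < m² →
              ∃[ b ] (b ≤ m × A b ≤ x × x < A (suc b) ×
                      ∃[ D ] (LFinv T (suc (α + x)) ≡ suc (β + D) × b * m² ≤ D × D < suc b * m²))
  LFinv-α+x {x} x<m² = LFinv-at-rank (SA-∈ α+x+1∈) (ISA-SA α+x+1∈)
    where
    α+x+1∈ : suc (α + x) ∈ range1 (length T)
    α+x+1∈ = ∈-range1⁺ (subst (α + x <_) α+m²≡length (+-monoʳ-< α x<m²))

-- Predecessors

Pred-sound : ∀ ys x {z} → Pred ys x ≡ just z → z ∈ ys × z < x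
Pred-sound (y ∷ ys) x eq with Pred ys x in rest | y <ᵇ x in y<ᵇx
Pred-sound (y ∷ ys) x eq   | _       | false with z∈ , z<x ← Pred-sound ys x (trans rest eq) = there z∈ , z<x
Pred-sound (y ∷ ys) x refl | nothing | true  = here refl , <ᵇ≡true⇒< y<ᵇx
Pred-sound (y ∷ ys) x refl | just w  | true  with w∈ , w<x ← Pred-sound ys x rest | ≤-total y w
... | inj₁ y≤w rewrite m≤n⇒m⊔n≡n y≤w = there w∈ , w<x
... | inj₂ w≤y rewrite m≥n⇒m⊔n≡m w≤y = here refl , <ᵇ≡true⇒< y<ᵇx

Pred-greatest : ∀ ys x {v} → v ∈ ys → v < x → (∀ {y} → y ∈ ys → y < x → y ≤ v) → Pred ys x ≡ just v
Pred-greatest (y ∷ ys) x v∈ v<x greatest with Pred ys x in rest | y <ᵇ x in y<ᵇx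
... | _       | false with v∈
...   | here refl  with () ← trans (sym y<ᵇx) (<ᵇ-true v<x)
...   | there v∈ys = trans (sym rest) (Pred-greatest ys x v∈ys v<x (λ y∈ → greatest (there y∈)))
Pred-greatest (y ∷ ys) x v∈ v<x greatest | nothing | true with v∈
...   | here refl  = refl
...   | there v∈ys with () ← trans (sym rest) (Pred-greatest ys x v∈ys v<x (λ y∈ → greatest (there y∈)))
Pred-greatest (y ∷ ys) x v∈ v<x greatest | just w  | true with w∈ , w<x ← Pred-sound ys x rest | v∈
...   | here refl  = cong just (m≥n⇒m⊔n≡m (greatest (there w∈) w<x))
...   | there v∈ys with refl ← trans (sym rest) (Pred-greatest ys x v∈ys v<x (λ y∈ → greatest (there y∈))) =
  cong just (m≤n⇒m⊔n≡n (greatest (here refl) (<ᵇ≡true⇒< y<ᵇx)))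

module Extension (m : ℕ) (a : Fin m → ℕ) where

  A : ℕ → ℕ
  A = ext m a

  B : List ℕ
  B = 0 ∷ tabulate a

  ext-< : ∀ {i} (i<m : i < m) → A (suc i) ≡ a (fromℕ< i<m)
  ext-< {i} i<m with i <? m
  ... | yes _   = refl
  ... | no  i≮m = contradiction i<m i≮m

  ext-last : A (suc m) ≡ m * m
  ext-last with m <? m
  ... | yes m<m = contradiction m<m (<-irrefl refl)
  ... | no  _   = refl

  ext-toℕ : ∀ j → A (suc (toℕ j)) ≡ a j
  ext-toℕ j = trans (ext-< (toℕ<n j)) (cong a (fromℕ<-toℕ j (toℕ<n j)))

  ∈B⁺ : ∀ {i} → i ≤ m → A i ∈ B
  ∈B⁺ {zero}  _       = here refl
  ∈B⁺ {suc i} 1+i≤m   = there (subst (_∈ tabulate a) (sym (ext-< 1+i≤m)) (∈-tabulate⁺ (fromℕ< 1+i≤m)))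

  ∈B⁻ : ∀ {y} → y ∈ B → ∃[ i ] (i ≤ m × y ≡ A i)
  ∈B⁻ (here refl) = 0 , z≤n , refl
  ∈B⁻ (there y∈) with j , refl ← ∈-tabulate⁻ y∈ = suc (toℕ j) , toℕ<n j , sym (ext-toℕ j)

  module _ (a-increasing : ∀ i j → i F.< j → a i < a j) (a-bounded : ∀ i → 1 ≤ a i × a i ≤ m * m) where

    ext-mono : ∀ {i j} → i ≤ j → j ≤ suc m → A i ≤ A j
    ext-mono = stepwise-mono A step
      where
      step : ∀ {i} → i < suc m → A i ≤ A (suc i)
      step {zero}  _     = z≤n
      step {suc i} 1+i<1+m with i<m ← s≤s⁻¹ 1+i<1+m | suc i <? m
      ... | yes 1+i<m = subst (_≤ a (fromℕ< 1+i<m)) (sym (ext-< i<m))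
                                 (<⇒≤ (a-increasing (fromℕ< i<m) (fromℕ< 1+i<m)
                                        (subst₂ _<_ (sym (toℕ-fromℕ< i<m)) (sym (toℕ-fromℕ< 1+i<m)) (n<1+n i))))
      ... | no _      = subst (_≤ m * m) (sym (ext-< i<m)) (proj₂ (a-bounded (fromℕ< i<m)))

    Pred-B : ∀ {b x} → b ≤ m → A b < x → x ≤ A (suc b) → Pred B x ≡ just (A b)
    Pred-B {b} {x} b≤m Ab<x x≤Ab+1 = Pred-greatest B x (∈B⁺ b≤m) Ab<x greatest
      where
      greatest : ∀ {y} → y ∈ B → y < x → y ≤ A b
      greatest y∈ y<x with i , i≤m , refl ← ∈B⁻ y∈ with i ≤? b
      ... | yes i≤b = ext-mono i≤b (m≤n⇒m≤1+n b≤m)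
      ... | no  i≰b = contradiction (≤-trans x≤Ab+1 (ext-mono (≰⇒> i≰b) (m≤n⇒m≤1+n i≤m))) (<⇒≱ y<x)

module _ (m : ℕ) (a : Fin m → ℕ) (a-increasing : ∀ i j → i F.< j → a i < a j)
         (a-bounded : ∀ i → 1 ≤ a i × a i ≤ m * m) (k : ℕ) (m<2^k : m < 2 ^ k) where

  open Extension m a
  open Construction m k A m<2^k refl (ext-mono a-increasing a-bounded) ext-last

  private
    α′ β′ : ℕ
    α′ = count (λ j → suffix T j ≺ᵇ (replicate (k + 2) true ++ (false ∷ []))) (range1 (length T))
    β′ = count (λ j → suffix T j ≺ᵇ (replicate (k + 1) true ++ (false ∷ []))) (range1 (length T))

    α′≡α : α′ ≡ α
    α′≡α = trans (count-suffixes T (_≺ᵇ (replicate (k + 2) true ++ false ∷ [])))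
                 (cong (λ n → rank T (replicate n true ++ false ∷ [])) (+-comm k 2))

    β′≡β : β′ ≡ β
    β′≡β = trans (count-suffixes T (_≺ᵇ (replicate (k + 1) true ++ false ∷ [])))
                 (cong (λ n → rank T (replicate n true ++ false ∷ [])) (+-comm k 1))

  Pred-from-LFinv : ∀ {x} → x < m * m →
                    ∃ λ i → ceilDiv (+ LFinv T (α′ + suc x) ℤ.- + β′) (m * m) ℤ.- + 1 ≡ + i × i ≤ m + 1 × Pred B (suc x) ≡ just (A i)
  Pred-from-LFinv {x} x<m² = from-bounds (LFinv-α+x x<m²)
    where
    -- A `with` on LFinv-α+x would normalise the goal and thereby unfold T.
    from-bounds : ∃[ b ] (b ≤ m × A b ≤ x × x < A (suc b) ×
                          ∃[ D ] (LFinv T (suc (α + x)) ≡ suc (β + D) × b * m² ≤ D × D < suc b * m²)) →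
                  ∃ λ i → ceilDiv (+ LFinv T (α′ + suc x) ℤ.- + β′) (m * m) ℤ.- + 1 ≡ + i × i ≤ m + 1 × Pred B (suc x) ≡ just (A i)
    from-bounds (b , b≤m , A-lower , A-upper , D , LFinv≡ , D-lower , D-upper) =
      b , index≡b , ≤-trans b≤m (m≤m+n m 1) , Pred-B a-increasing a-bounded b≤m (s≤s A-lower) A-upper
      where
      open ≡-Reasoning
      index : ℕ → ℕ → ℤ
      index r s = ceilDiv (+ r ℤ.- + s) (m * m) ℤ.- + 1
      index≡b : index (LFinv T (α′ + suc x)) β′ ≡ + b
      index≡b = begin
        index (LFinv T (α′ + suc x)) β′    ≡⟨ cong₂ (λ α″ β″ → index (LFinv T (α″ + suc x)) β″) α′≡α β′≡β ⟩
        index (LFinv T (α + suc x)) β      ≡⟨ cong (λ r → index (LFinv T r) β) (+-suc α x) ⟩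
        index (LFinv T (suc (α + x))) β    ≡⟨ cong (λ r → index r β) (trans LFinv≡ (sym (+-suc β D))) ⟩
        index (β + suc D) β                ≡⟨ cong (λ z → ceilDiv z (m * m) ℤ.- + 1) (+[m+n]-+m β (suc D)) ⟩
        ceilDiv (+ suc D) (m * m) ℤ.- + 1  ≡⟨ cong (ℤ._- + 1) (ceilDiv-suc (≤-<-trans z≤n x<m²) D-lower D-upper) ⟩
        + b                                ∎

mainTheorem13 : (m : ℕ) → 1 ≤ m → (a : Fin m → ℕ)
  → (∀ i j → i F.< j → a i < a j)
  → (∀ i → 1 ≤ a i × a i ≤ m * m)
  → (x : ℕ) → 1 ≤ x → x ≤ m * m
  → let k = 1 + ⌊log₂ m ⌋
        T = Tstr m k (ext m a)
        α = count (λ j → suffix T j ≺ᵇ (replicate (k + 2) true ++ (false ∷ []))) (range1 (length T))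
        β = count (λ j → suffix T j ≺ᵇ (replicate (k + 1) true ++ (false ∷ []))) (range1 (length T))
        B = 0 ∷ tabulate a
        c = ceilDiv (+ LFinv T (α + x) ℤ.- + β) (m * m) ℤ.- + 1
    in ∃ λ i → c ≡ + i × i ≤ m + 1 × Pred B x ≡ just (ext m a i)
mainTheorem13 m _ a a-increasing a-bounded (suc x) _ 1+x≤m² =
  Pred-from-LFinv m a a-increasing a-bounded (1 + ⌊log₂ m ⌋) (<2^1+⌊log₂⌋ m) 1+x≤m²
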